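{- In the $!$-free fragment described in the context, if $\Gamma\vdash t:A$ and $t\to u$, then $\mu(t)\geq\mu(u)$.
   Context: Let $\mathcal S$ be a semiring. ($!$-free fragment of the $\mathcal{L}^{\mathcal S}_2$-calculus.) Propositions (modulo $\alpha$): $A ::= X \mid \mathbf 1 \mid A\multimap A\mid A\otimes A\mid \top\mid \mathbf 0\mid A\,\&\,A\mid A\oplus A\mid \forall X.A$. Proof-terms (modulo $\alpha$; $a\in\mathcal S$): $t ::= x \mid t\boxplus u\mid a\bullet t\mid a.\star\mid \delta_{\mathbf 1}(t,u)\mid \lambda x^A.t\mid t\,u\mid t\otimes u\mid \delta_\otimes(t,x^Ay^B.u)\mid\langle\rangle\mid \delta_{\mathbf 0}(t) \mid \langle t,u\rangle\mid \delta^1_\&(t,x^A.u)\mid\delta^2_\&(t,x^B.u)\mid \mathrm{inl}(t)\mid\mathrm{inr}(t)\mid\delta_\oplus(t,x^A.u,y^B.v)\mid\Lambda X.t\mid t\,A$ ($\boxplus$: proof-term sum). Sequents $\Gamma\vdash t:A$ with $\Gamma$ a linear context ($\Gamma,\Delta$ disjoint union). Rules: $x^A\vdash x:A$; from $\Gamma\vdash t:A$ and $\Gamma\vdash u:A$ infer $\Gamma\vdash t\boxplus u:A$; from $\Gamma\vdash t:A$ infer $\Gamma\vdash a\bullet t:A$; $\vdash a.\star:\mathbf 1$; from $\Gamma\vdash t:\mathbf 1$, $\Delta\vdash u:A$ infer $\Gamma,\Delta\vdash\delta_{\mathbf 1}(t,u):A$; from $\Gamma,x^A\vdash t:B$ infer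 $\Gamma\vdash\lambda x^A.t:A\multimap B$; from $\Gamma\vdash t:A\multimap B$, $\Delta\vdash u:A$ infer $\Gamma,\Delta\vdash t\,u:B$; from $\Gamma\vdash t:A$, $\Delta\vdash u:B$ infer $\Gamma,\Delta\vdash t\otimes u:A\otimes B$; from $\Gamma\vdash t:A\otimes B$, $\Delta,x^A,y^B\vdash u:C$ infer $\Gamma,\Delta\vdash\delta_\otimes(t,x^Ay^B.u):C$; $\Gamma\vdash\langle\rangle:\top$; from $\Gamma\vdash t:\mathbf 0$ infer $\Gamma,\Delta\vdash\delta_{\mathbf 0}(t):C$; from $\Gamma\vdash t:A$, $\Gamma\vdash u:B$ infer $\Gamma\vdash\langle t,u\rangle:A\&B$; from $\Gamma\vdash t:A\&B$, $\Delta,x^A\vdash u:C$ infer $\Gamma,\Delta\vdash\delta^1_\&(t,x^A.u):C$; from $\Gamma\vdash t:A\&B$, $\Delta,x^B\vdash u:C$ infer $\Gamma,\Delta\vdash\delta^2_\&(t,x^B.u):C$; from $\Gamma\vdash t:A$ infer $\Gamma\vdash\mathrm{inl}(t):A\oplus B$; from $\Gamma\vdash t:B$ infer $\Gamma\vdash\mathrm{inr}(t):A\oplus B$; from $\Gamma\vdash t:A\oplus B$, $\Delta,x^A\vdash u:C$, $\Delta,y^B\vdash v:C$ infer $\Gamma,\Delta\vdash\delta_\oplus(t,x^A.u,y^B.v):C$; from $\Gamma\vdash t:A$ with $X\notin FV(\Gamma)$ infer $\Gamma\vdash\Lambda X.t:\forall X.A$; from $\Gamma\vdash t:\forall X.B$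 infer $\Gamma\vdash t\,A:(A/X)B$. Reduction $\to$ is the closure under all contexts of: $\delta_{\mathbf 1}(a.\star,t)\to a\bullet t$; $(\lambda x^A.t)\,u\to(u/x)t$; $\delta_\otimes(u\otimes v,x^Ay^B.w)\to(u/x,v/y)w$; $\delta^i_\&(\langle t_1,t_2\rangle,x.v)\to(t_i/x)v$; $\delta_\oplus(\mathrm{inl}(t),x^A.v,y^B.w)\to(t/x)v$; $\delta_\oplus(\mathrm{inr}(u),x^A.v,y^B.w)\to(u/y)w$; $(\Lambda X.t)\,A\to(A/X)t$; $a.\star\boxplus b.\star\to(a+b).\star$; $(\lambda x^A.t)\boxplus(\lambda x^A.u)\to\lambda x^A.(t\boxplus u)$; $\delta_\otimes(t\boxplus u,x^Ay^B.v)\to\delta_\otimes(t,x^Ay^B.v)\boxplus\delta_\otimes(u,x^Ay^B.v)$; $\langle\rangle\boxplus\langle\rangle\to\langle\rangle$; $\langle t,u\rangle\boxplus\langle v,w\rangle\to\langle t\boxplus v,u\boxplus w\rangle$; $\delta_\oplus(t\boxplus u,x^A.v,y^B.w)\to\delta_\oplus(t,x^A.v,y^B.w)\boxplus\delta_\oplus(u,x^A.v,y^B.w)$; $(\Lambda X.t)\boxplus(\Lambda X.u)\to\Lambda X.(t\boxplus u)$; $a\bullet b.\star\to(a\times b).\star$; $a\bullet\lambda x^A.t\to\lambda x^A.a\bullet t$; $\delta_\otimes(a\bullet t,x^Ay^B.v)\to a\bullet\delta_\otimes(t,x^Ay^B.v)$; $a\bullet\langle\rangle\to\langle\rangle$;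 $a\bullet\langle t,u\rangle\to\langle a\bullet t,a\bullet u\rangle$; $\delta_\oplus(a\bullet t,x^A.v,y^B.w)\to a\bullet\delta_\oplus(t,x^A.v,y^B.w)$; $a\bullet\Lambda X.t\to\Lambda X.a\bullet t$. The measure $\mu$ is defined by: $\mu(x)=0$; $\mu(t\boxplus u)=1+\max(\mu(t),\mu(u))$; $\mu(a\bullet t)=1+\mu(t)$; $\mu(a.\star)=1$; $\mu(\delta_{\mathbf 1}(t,u))=1+\mu(t)+\mu(u)$; $\mu(\lambda x^A.t)=1+\mu(t)$; $\mu(t\,u)=1+\mu(t)+\mu(u)$; $\mu(t\otimes u)=1+\mu(t)+\mu(u)$; $\mu(\delta_\otimes(t,x^Ay^B.u))=1+\mu(t)+\mu(u)$; $\mu(\langle\rangle)=1$; $\mu(\delta_{\mathbf 0}(t))=1+\mu(t)$; $\mu(\langle t,u\rangle)=1+\max(\mu(t),\mu(u))$; $\mu(\delta^i_\&(t,y.u))=1+\mu(t)+\mu(u)$ ($i=1,2$); $\mu(\mathrm{inl}(t))=\mu(\mathrm{inr}(t))=1+\mu(t)$; $\mu(\delta_\oplus(t,y^A.u,z^B.v))=1+\mu(t)+\max(\mu(u),\mu(v))$; $\mu(\Lambda X.t)=1+\mu(t)$; $\mu(t\,A)=1+\mu(t)$. -}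

module Defs where

open import Level using (Level)
open import Data.Nat using (ℕ; zero; suc; _+_; _⊔_)
open import Data.List using (List; []; _∷_; map)
open import Data.Maybe using (Maybe; just; nothing)
import Data.Maybe as Maybe
open import Algebra.Bundles using (Semiring)

-- Propositions, with de Bruijn indices for propositional variables
-- (this represents propositions modulo α-equivalence).

data Ty : Set where
  tv   : ℕ → Ty
  𝟙    : Ty
  _⊸_  : Ty → Ty → Ty
  _⊗_  : Ty → Ty → Ty
  ⊤ₜ   : Ty
  𝟘    : Ty
  _&_  : Ty → Ty → Ty
  _⊕_  : Ty → Ty → Ty
  ∀̇    : Ty → Ty           -- ∀X.A   (binds index 0)

ext : (ℕ → ℕ) → ℕ → ℕ
ext ρ zero    = zero
ext ρ (suc n) = suc (ρ n)

tyRen : (ℕ → ℕ) → Ty → Ty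
tyRen ρ (tv n)  = tv (ρ n)
tyRen ρ 𝟙       = 𝟙
tyRen ρ (A ⊸ B) = tyRen ρ A ⊸ tyRen ρ B
tyRen ρ (A ⊗ B) = tyRen ρ A ⊗ tyRen ρ B
tyRen ρ ⊤ₜ      = ⊤ₜ
tyRen ρ 𝟘       = 𝟘
tyRen ρ (A & B) = tyRen ρ A & tyRen ρ B
tyRen ρ (A ⊕ B) = tyRen ρ A ⊕ tyRen ρ B
tyRen ρ (∀̇ A)   = ∀̇ (tyRen (ext ρ) A)

extsT : (ℕ → Ty) → ℕ → Ty
extsT σ zero    = tv zero
extsT σ (suc n) = tyRen suc (σ n)

tySub : (ℕ → Ty) → Ty → Ty
tySub σ (tv n)  = σ n
tySub σ 𝟙       = 𝟙
tySub σ (A ⊸ B) = tySub σ A ⊸ tySub σ B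
tySub σ (A ⊗ B) = tySub σ A ⊗ tySub σ B
tySub σ ⊤ₜ      = ⊤ₜ
tySub σ 𝟘       = 𝟘
tySub σ (A & B) = tySub σ A & tySub σ B
tySub σ (A ⊕ B) = tySub σ A ⊕ tySub σ B
tySub σ (∀̇ A)   = ∀̇ (tySub (extsT σ) A)

tyShift : Ty → Ty
tyShift = tyRen suc

tyInst : Ty → Ty → Ty
tyInst A B = tySub σ B
  where
  σ : ℕ → Ty
  σ zero    = A
  σ (suc n) = tv n

module Calc {c ℓ : Level} (S : Semiring c ℓ) where

  open Semiring S using (Carrier) renaming (_+_ to _+ₛ_; _*_ to _*ₛ_)

  -- Binders: lam A t binds index 0 in t;
  --   δ⊗ t A B u  (= δ⊗(t, x^A y^B. u)) binds y as index 0 and x as index 1 in u;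
  --   δ&₁ t A u, δ&₂ t B u bind index 0 in u;
  --   δ⊕ t A u B v binds index 0 in u (type A) and in v (type B);
  --   Λ t binds propositional variable index 0 in t.
  infixl 6 _⊞_
  data Tm : Set c where
    var  : ℕ → Tm
    _⊞_  : Tm → Tm → Tm
    _•_  : Carrier → Tm → Tm
    star : Carrier → Tm
    δ𝟙   : Tm → Tm → Tm
    lam  : Ty → Tm → Tm
    app  : Tm → Tm → Tm
    tens : Tm → Tm → Tm
    δ⊗   : Tm → Ty → Ty → Tm → Tm
    triv : Tm
    δ𝟘   : Tm → Tm
    wpair : Tm → Tm → Tm
    δ&₁  : Tm → Ty → Tm → Tm
    δ&₂  : Tm → Ty → Tm → Tm
    inl  : Tm → Tm
    inr  : Tm → Tm
    δ⊕   : Tm → Ty → Tm → Ty → Tm → Tm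
    Λ    : Tm → Tm
    tapp : Tm → Ty → Tm

  tmTySub : (ℕ → Ty) → Tm → Tm
  tmTySub σ (var x)         = var x
  tmTySub σ (t ⊞ u)         = tmTySub σ t ⊞ tmTySub σ u
  tmTySub σ (a • t)         = a • tmTySub σ t
  tmTySub σ (star a)        = star a
  tmTySub σ (δ𝟙 t u)        = δ𝟙 (tmTySub σ t) (tmTySub σ u)
  tmTySub σ (lam A t)       = lam (tySub σ A) (tmTySub σ t)
  tmTySub σ (app t u)       = app (tmTySub σ t) (tmTySub σ u)
  tmTySub σ (tens t u)      = tens (tmTySub σ t) (tmTySub σ u)
  tmTySub σ (δ⊗ t A B u)    = δ⊗ (tmTySub σ t) (tySub σ A) (tySub σ B) (tmTySub σ u)
  tmTySub σ triv            = triv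
  tmTySub σ (δ𝟘 t)          = δ𝟘 (tmTySub σ t)
  tmTySub σ (wpair t u)     = wpair (tmTySub σ t) (tmTySub σ u)
  tmTySub σ (δ&₁ t A u)     = δ&₁ (tmTySub σ t) (tySub σ A) (tmTySub σ u)
  tmTySub σ (δ&₂ t A u)     = δ&₂ (tmTySub σ t) (tySub σ A) (tmTySub σ u)
  tmTySub σ (inl t)         = inl (tmTySub σ t)
  tmTySub σ (inr t)         = inr (tmTySub σ t)
  tmTySub σ (δ⊕ t A u B v)  = δ⊕ (tmTySub σ t) (tySub σ A) (tmTySub σ u) (tySub σ B) (tmTySub σ v)
  tmTySub σ (Λ t)           = Λ (tmTySub (extsT σ) t)
  tmTySub σ (tapp t A)      = tapp (tmTySub σ t) (tySub σ A)

  tmTyShift : Tm → Tm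
  tmTyShift = tmTySub (λ n → tv (suc n))

  tmTyInst : Ty → Tm → Tm
  tmTyInst A t = tmTySub σ t
    where
    σ : ℕ → Ty
    σ zero    = A
    σ (suc n) = tv n

  tmRen : (ℕ → ℕ) → Tm → Tm
  tmRen ρ (var x)         = var (ρ x)
  tmRen ρ (t ⊞ u)         = tmRen ρ t ⊞ tmRen ρ u
  tmRen ρ (a • t)         = a • tmRen ρ t
  tmRen ρ (star a)        = star a
  tmRen ρ (δ𝟙 t u)        = δ𝟙 (tmRen ρ t) (tmRen ρ u)
  tmRen ρ (lam A t)       = lam A (tmRen (ext ρ) t)
  tmRen ρ (app t u)       = app (tmRen ρ t) (tmRen ρ u)
  tmRen ρ (tens t u)      = tens (tmRen ρ t) (tmRen ρ u)
  tmRen ρ (δ⊗ t A B u)    = δ⊗ (tmRen ρ t) A B (tmRen (ext (ext ρ)) u)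
  tmRen ρ triv            = triv
  tmRen ρ (δ𝟘 t)          = δ𝟘 (tmRen ρ t)
  tmRen ρ (wpair t u)     = wpair (tmRen ρ t) (tmRen ρ u)
  tmRen ρ (δ&₁ t A u)     = δ&₁ (tmRen ρ t) A (tmRen (ext ρ) u)
  tmRen ρ (δ&₂ t A u)     = δ&₂ (tmRen ρ t) A (tmRen (ext ρ) u)
  tmRen ρ (inl t)         = inl (tmRen ρ t)
  tmRen ρ (inr t)         = inr (tmRen ρ t)
  tmRen ρ (δ⊕ t A u B v)  = δ⊕ (tmRen ρ t) A (tmRen (ext ρ) u) B (tmRen (ext ρ) v)
  tmRen ρ (Λ t)           = Λ (tmRen ρ t)
  tmRen ρ (tapp t A)      = tapp (tmRen ρ t) A

  exts : (ℕ → Tm) → ℕ → Tm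
  exts σ zero    = var zero
  exts σ (suc n) = tmRen suc (σ n)

  tmSub : (ℕ → Tm) → Tm → Tm
  tmSub σ (var x)         = σ x
  tmSub σ (t ⊞ u)         = tmSub σ t ⊞ tmSub σ u
  tmSub σ (a • t)         = a • tmSub σ t
  tmSub σ (star a)        = star a
  tmSub σ (δ𝟙 t u)        = δ𝟙 (tmSub σ t) (tmSub σ u)
  tmSub σ (lam A t)       = lam A (tmSub (exts σ) t)
  tmSub σ (app t u)       = app (tmSub σ t) (tmSub σ u)
  tmSub σ (tens t u)      = tens (tmSub σ t) (tmSub σ u)
  tmSub σ (δ⊗ t A B u)    = δ⊗ (tmSub σ t) A B (tmSub (exts (exts σ)) u)
  tmSub σ triv            = triv
  tmSub σ (δ𝟘 t)          = δ𝟘 (tmSub σ t)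
  tmSub σ (wpair t u)     = wpair (tmSub σ t) (tmSub σ u)
  tmSub σ (δ&₁ t A u)     = δ&₁ (tmSub σ t) A (tmSub (exts σ) u)
  tmSub σ (δ&₂ t A u)     = δ&₂ (tmSub σ t) A (tmSub (exts σ) u)
  tmSub σ (inl t)         = inl (tmSub σ t)
  tmSub σ (inr t)         = inr (tmSub σ t)
  tmSub σ (δ⊕ t A u B v)  = δ⊕ (tmSub σ t) A (tmSub (exts σ) u) B (tmSub (exts σ) v)
  tmSub σ (Λ t)           = Λ (tmSub (λ n → tmTyShift (σ n)) t)
  tmSub σ (tapp t A)      = tapp (tmSub σ t) A

  sub1 : Tm → Tm → Tm
  sub1 u t = tmSub σ t
    where
    σ : ℕ → Tm
    σ zero    = u
    σ (suc n) = var n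

  sub2 : Tm → Tm → Tm → Tm
  sub2 u v w = tmSub σ w
    where
    σ : ℕ → Tm
    σ zero          = v
    σ (suc zero)    = u
    σ (suc (suc n)) = var n

  -- Linear contexts: a context is a list over all proof-variable indices
  -- in scope; entry `just A` means the variable (of type A) belongs to the
  -- context, `nothing` means it does not.

  Ctx : Set
  Ctx = List (Maybe Ty)

  data Empty : Ctx → Set where
    []  : Empty []
    ∅∷_ : ∀ {Γ} → Empty Γ → Empty (nothing ∷ Γ)

  data Only : ℕ → Ty → Ctx → Set where
    here  : ∀ {A Γ} → Empty Γ → Only zero A (just A ∷ Γ)
    there : ∀ {n A Γ} → Only n A Γ → Only (suc n) A (nothing ∷ Γ)

  data Split : Ctx → Ctx → Ctx → Set where
    []     : Split [] [] []
    left   : ∀ {A Ξ Γ Δ} → Split Ξ Γ Δ → Split (just A ∷ Ξ) (just A ∷ Γ) (nothing ∷ Δ)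
    right  : ∀ {A Ξ Γ Δ} → Split Ξ Γ Δ → Split (just A ∷ Ξ) (nothing ∷ Γ) (just A ∷ Δ)
    absent : ∀ {Ξ Γ Δ} → Split Ξ Γ Δ → Split (nothing ∷ Ξ) (nothing ∷ Γ) (nothing ∷ Δ)

  -- shifting the propositions of a context (going under ΛX; this encodes X ∉ FV(Γ))
  ctxShift : Ctx → Ctx
  ctxShift = map (Maybe.map tyShift)

  infix 4 _⊢_∶_
  data _⊢_∶_ : Ctx → Tm → Ty → Set c where
    ax    : ∀ {x A Γ} → Only x A Γ → Γ ⊢ var x ∶ A
    sum   : ∀ {Γ t u A} → Γ ⊢ t ∶ A → Γ ⊢ u ∶ A → Γ ⊢ t ⊞ u ∶ A
    prod  : ∀ {Γ t A} (a : Carrier) → Γ ⊢ t ∶ A → Γ ⊢ a • t ∶ A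
    𝟙i    : ∀ {Γ} (a : Carrier) → Empty Γ → Γ ⊢ star a ∶ 𝟙
    𝟙e    : ∀ {Ξ Γ Δ t u A} → Split Ξ Γ Δ → Γ ⊢ t ∶ 𝟙 → Δ ⊢ u ∶ A → Ξ ⊢ δ𝟙 t u ∶ A
    ⊸i    : ∀ {Γ t A B} → just A ∷ Γ ⊢ t ∶ B → Γ ⊢ lam A t ∶ A ⊸ B
    ⊸e    : ∀ {Ξ Γ Δ t u A B} → Split Ξ Γ Δ → Γ ⊢ t ∶ A ⊸ B → Δ ⊢ u ∶ A → Ξ ⊢ app t u ∶ B
    ⊗i    : ∀ {Ξ Γ Δ t u A B} → Split Ξ Γ Δ → Γ ⊢ t ∶ A → Δ ⊢ u ∶ B → Ξ ⊢ tens t u ∶ A ⊗ B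
    ⊗e    : ∀ {Ξ Γ Δ t u A B C} → Split Ξ Γ Δ → Γ ⊢ t ∶ A ⊗ B
            → just B ∷ just A ∷ Δ ⊢ u ∶ C → Ξ ⊢ δ⊗ t A B u ∶ C
    ⊤i    : ∀ {Γ} → Γ ⊢ triv ∶ ⊤ₜ
    𝟘e    : ∀ {Ξ Γ Δ t C} → Split Ξ Γ Δ → Γ ⊢ t ∶ 𝟘 → Ξ ⊢ δ𝟘 t ∶ C
    &i    : ∀ {Γ t u A B} → Γ ⊢ t ∶ A → Γ ⊢ u ∶ B → Γ ⊢ wpair t u ∶ A & B
    &e₁   : ∀ {Ξ Γ Δ t u A B C} → Split Ξ Γ Δ → Γ ⊢ t ∶ A & B
            → just A ∷ Δ ⊢ u ∶ C → Ξ ⊢ δ&₁ t A u ∶ C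
    &e₂   : ∀ {Ξ Γ Δ t u A B C} → Split Ξ Γ Δ → Γ ⊢ t ∶ A & B
            → just B ∷ Δ ⊢ u ∶ C → Ξ ⊢ δ&₂ t B u ∶ C
    ⊕i₁   : ∀ {Γ t A B} → Γ ⊢ t ∶ A → Γ ⊢ inl t ∶ A ⊕ B
    ⊕i₂   : ∀ {Γ t A B} → Γ ⊢ t ∶ B → Γ ⊢ inr t ∶ A ⊕ B
    ⊕e    : ∀ {Ξ Γ Δ t u v A B C} → Split Ξ Γ Δ → Γ ⊢ t ∶ A ⊕ B
            → just A ∷ Δ ⊢ u ∶ C → just B ∷ Δ ⊢ v ∶ C → Ξ ⊢ δ⊕ t A u B v ∶ C
    ∀i    : ∀ {Γ t A} → ctxShift Γ ⊢ t ∶ A → Γ ⊢ Λ t ∶ ∀̇ A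
    ∀e    : ∀ {Γ t B} (A : Ty) → Γ ⊢ t ∶ ∀̇ B → Γ ⊢ tapp t A ∶ tyInst A B

  infix 4 _⟶_
  data _⟶_ : Tm → Tm → Set c where
    β𝟙    : ∀ {a t} → δ𝟙 (star a) t ⟶ a • t
    β⊸    : ∀ {A t u} → app (lam A t) u ⟶ sub1 u t
    β⊗    : ∀ {u v A B w} → δ⊗ (tens u v) A B w ⟶ sub2 u v w
    β&₁   : ∀ {t₁ t₂ A v} → δ&₁ (wpair t₁ t₂) A v ⟶ sub1 t₁ v
    β&₂   : ∀ {t₁ t₂ A v} → δ&₂ (wpair t₁ t₂) A v ⟶ sub1 t₂ v
    β⊕₁   : ∀ {t A v B w} → δ⊕ (inl t) A v B w ⟶ sub1 t v
    β⊕₂   : ∀ {u A v B w} → δ⊕ (inr u) A v B w ⟶ sub1 u w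
    β∀    : ∀ {t A} → tapp (Λ t) A ⟶ tmTyInst A t
    ⊞𝟙    : ∀ {a b} → star a ⊞ star b ⟶ star (a +ₛ b)
    ⊞⊸    : ∀ {A t u} → lam A t ⊞ lam A u ⟶ lam A (t ⊞ u)
    ⊞⊗    : ∀ {t u A B v} → δ⊗ (t ⊞ u) A B v ⟶ δ⊗ t A B v ⊞ δ⊗ u A B v
    ⊞⊤    : triv ⊞ triv ⟶ triv
    ⊞&    : ∀ {t u v w} → wpair t u ⊞ wpair v w ⟶ wpair (t ⊞ v) (u ⊞ w)
    ⊞⊕    : ∀ {t u A v B w} → δ⊕ (t ⊞ u) A v B w ⟶ δ⊕ t A v B w ⊞ δ⊕ u A v B w
    ⊞∀    : ∀ {t u} → Λ t ⊞ Λ u ⟶ Λ (t ⊞ u)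
    •𝟙    : ∀ {a b} → a • star b ⟶ star (a *ₛ b)
    •⊸    : ∀ {a A t} → a • lam A t ⟶ lam A (a • t)
    •⊗    : ∀ {a t A B v} → δ⊗ (a • t) A B v ⟶ a • δ⊗ t A B v
    •⊤    : ∀ {a} → a • triv ⟶ triv
    •&    : ∀ {a t u} → a • wpair t u ⟶ wpair (a • t) (a • u)
    •⊕    : ∀ {a t A v B w} → δ⊕ (a • t) A v B w ⟶ a • δ⊕ t A v B w
    •∀    : ∀ {a t} → a • Λ t ⟶ Λ (a • t)
    c⊞₁   : ∀ {t t' u} → t ⟶ t' → t ⊞ u ⟶ t' ⊞ u
    c⊞₂   : ∀ {t u u'} → u ⟶ u' → t ⊞ u ⟶ t ⊞ u'
    c•    : ∀ {a t t'} → t ⟶ t' → a • t ⟶ a • t'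
    cδ𝟙₁  : ∀ {t t' u} → t ⟶ t' → δ𝟙 t u ⟶ δ𝟙 t' u
    cδ𝟙₂  : ∀ {t u u'} → u ⟶ u' → δ𝟙 t u ⟶ δ𝟙 t u'
    clam  : ∀ {A t t'} → t ⟶ t' → lam A t ⟶ lam A t'
    capp₁ : ∀ {t t' u} → t ⟶ t' → app t u ⟶ app t' u
    capp₂ : ∀ {t u u'} → u ⟶ u' → app t u ⟶ app t u'
    ctens₁ : ∀ {t t' u} → t ⟶ t' → tens t u ⟶ tens t' u
    ctens₂ : ∀ {t u u'} → u ⟶ u' → tens t u ⟶ tens t u'
    cδ⊗₁  : ∀ {t t' A B u} → t ⟶ t' → δ⊗ t A B u ⟶ δ⊗ t' A B u
    cδ⊗₂  : ∀ {t A B u u'} → u ⟶ u' → δ⊗ t A B u ⟶ δ⊗ t A B u'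
    cδ𝟘   : ∀ {t t'} → t ⟶ t' → δ𝟘 t ⟶ δ𝟘 t'
    cpair₁ : ∀ {t t' u} → t ⟶ t' → wpair t u ⟶ wpair t' u
    cpair₂ : ∀ {t u u'} → u ⟶ u' → wpair t u ⟶ wpair t u'
    cδ&₁₁ : ∀ {t t' A u} → t ⟶ t' → δ&₁ t A u ⟶ δ&₁ t' A u
    cδ&₁₂ : ∀ {t A u u'} → u ⟶ u' → δ&₁ t A u ⟶ δ&₁ t A u'
    cδ&₂₁ : ∀ {t t' A u} → t ⟶ t' → δ&₂ t A u ⟶ δ&₂ t' A u
    cδ&₂₂ : ∀ {t A u u'} → u ⟶ u' → δ&₂ t A u ⟶ δ&₂ t A u'
    cinl  : ∀ {t t'} → t ⟶ t' → inl t ⟶ inl t'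
    cinr  : ∀ {t t'} → t ⟶ t' → inr t ⟶ inr t'
    cδ⊕₁  : ∀ {t t' A u B v} → t ⟶ t' → δ⊕ t A u B v ⟶ δ⊕ t' A u B v
    cδ⊕₂  : ∀ {t A u u' B v} → u ⟶ u' → δ⊕ t A u B v ⟶ δ⊕ t A u' B v
    cδ⊕₃  : ∀ {t A u B v v'} → v ⟶ v' → δ⊕ t A u B v ⟶ δ⊕ t A u B v'
    cΛ    : ∀ {t t'} → t ⟶ t' → Λ t ⟶ Λ t'
    ctapp : ∀ {t t' A} → t ⟶ t' → tapp t A ⟶ tapp t' A

  μ : Tm → ℕ
  μ (var x)        = 0
  μ (t ⊞ u)        = suc (μ t ⊔ μ u)
  μ (a • t)        = suc (μ t)
  μ (star a)       = 1
  μ (δ𝟙 t u)       = suc (μ t + μ u)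
  μ (lam A t)      = suc (μ t)
  μ (app t u)      = suc (μ t + μ u)
  μ (tens t u)     = suc (μ t + μ u)
  μ (δ⊗ t A B u)   = suc (μ t + μ u)
  μ triv           = 1
  μ (δ𝟘 t)         = suc (μ t)
  μ (wpair t u)    = suc (μ t ⊔ μ u)
  μ (δ&₁ t A u)    = suc (μ t + μ u)
  μ (δ&₂ t A u)    = suc (μ t + μ u)
  μ (inl t)        = suc (μ t)
  μ (inr t)        = suc (μ t)
  μ (δ⊕ t A u B v) = suc (μ t + (μ u ⊔ μ v))
  μ (Λ t)          = suc (μ t)
  μ (tapp t A)     = suc (μ t)

{-# OPTIONS --safe #-}

-- A β-step replaces a redex of measure 2 + μ t + μ u by a substitution
-- instance (u/x)t. Because contexts are linear, μ((u/x)t) ≤ μ t + μ u: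
-- multiplicative rules split the context and μ adds the measures of the
-- premises, while additive rules (⊞, &, the branches of ⊕) share it and μ
-- takes their maximum. Propositional substitution does not change μ, and
-- the commutation rules push a ⊞ or a • inwards (or evaluate it on
-- constants), which cannot increase μ since μ(t ⊞ u) uses a maximum.

module Submission where

open import Defs
open import Level using (Level)
open import Data.Nat using (ℕ; suc; _+_; _⊔_; _≤_; _≥_; s≤s; z≤n)
open import Data.Nat.Properties
open import Data.List using ([]; _∷_)
open import Data.Maybe using (just; nothing)
open import Function using (_∘_; id)
open import Relation.Binary.PropositionalEquality
open import Algebra.Bundles using (Semiring)
open import Algebra.Properties.CommutativeSemigroup +-commutativeSemigroup
  using ()
  renaming ( interchange to +-interchange
           ; x∙yz≈y∙xz to x+[y+z]≡y+[x+z]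
           ; x∙yz≈zy∙x to x+[y+z]≡[z+y]+x
           )
open import Algebra.Properties.CommutativeSemigroup ⊔-commutativeSemigroup
  using () renaming (interchange to ⊔-interchange)

⊔-mono-≤-+ : ∀ {a b} x y w → a ≤ x + w → b ≤ y + w → a ⊔ b ≤ (x ⊔ y) + w
⊔-mono-≤-+ x y w a≤ b≤ =
  ≤-trans (⊔-mono-≤ a≤ b≤) (≤-reflexive (sym (+-distribʳ-⊔ w x y)))

module _ {c ℓ : Level} (S : Semiring c ℓ) where
  open Calc S

  μ-tmRen : ∀ ρ t → μ (tmRen ρ t) ≡ μ t
  μ-tmRen ρ (var x)        = refl
  μ-tmRen ρ (t ⊞ u)        = cong₂ (λ m n → suc (m ⊔ n)) (μ-tmRen ρ t) (μ-tmRen ρ u)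
  μ-tmRen ρ (a • t)        = cong suc (μ-tmRen ρ t)
  μ-tmRen ρ (star a)       = refl
  μ-tmRen ρ (δ𝟙 t u)       = cong₂ (λ m n → suc (m + n)) (μ-tmRen ρ t) (μ-tmRen ρ u)
  μ-tmRen ρ (lam A t)      = cong suc (μ-tmRen (ext ρ) t)
  μ-tmRen ρ (app t u)      = cong₂ (λ m n → suc (m + n)) (μ-tmRen ρ t) (μ-tmRen ρ u)
  μ-tmRen ρ (tens t u)     = cong₂ (λ m n → suc (m + n)) (μ-tmRen ρ t) (μ-tmRen ρ u)
  μ-tmRen ρ (δ⊗ t A B u)   = cong₂ (λ m n → suc (m + n)) (μ-tmRen ρ t) (μ-tmRen (ext (ext ρ)) u)
  μ-tmRen ρ triv           = refl
  μ-tmRen ρ (δ𝟘 t)         = cong suc (μ-tmRen ρ t)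
  μ-tmRen ρ (wpair t u)    = cong₂ (λ m n → suc (m ⊔ n)) (μ-tmRen ρ t) (μ-tmRen ρ u)
  μ-tmRen ρ (δ&₁ t A u)    = cong₂ (λ m n → suc (m + n)) (μ-tmRen ρ t) (μ-tmRen (ext ρ) u)
  μ-tmRen ρ (δ&₂ t A u)    = cong₂ (λ m n → suc (m + n)) (μ-tmRen ρ t) (μ-tmRen (ext ρ) u)
  μ-tmRen ρ (inl t)        = cong suc (μ-tmRen ρ t)
  μ-tmRen ρ (inr t)        = cong suc (μ-tmRen ρ t)
  μ-tmRen ρ (δ⊕ t A u B v) = cong₂ (λ m n → suc (m + n)) (μ-tmRen ρ t)
                               (cong₂ _⊔_ (μ-tmRen (ext ρ) u) (μ-tmRen (ext ρ) v))
  μ-tmRen ρ (Λ t)          = cong suc (μ-tmRen ρ t)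
  μ-tmRen ρ (tapp t A)     = cong suc (μ-tmRen ρ t)

  μ-tmTySub : ∀ σ t → μ (tmTySub σ t) ≡ μ t
  μ-tmTySub σ (var x)        = refl
  μ-tmTySub σ (t ⊞ u)        = cong₂ (λ m n → suc (m ⊔ n)) (μ-tmTySub σ t) (μ-tmTySub σ u)
  μ-tmTySub σ (a • t)        = cong suc (μ-tmTySub σ t)
  μ-tmTySub σ (star a)       = refl
  μ-tmTySub σ (δ𝟙 t u)       = cong₂ (λ m n → suc (m + n)) (μ-tmTySub σ t) (μ-tmTySub σ u)
  μ-tmTySub σ (lam A t)      = cong suc (μ-tmTySub σ t)
  μ-tmTySub σ (app t u)      = cong₂ (λ m n → suc (m + n)) (μ-tmTySub σ t) (μ-tmTySub σ u)
  μ-tmTySub σ (tens t u)     = cong₂ (λ m n → suc (m + n)) (μ-tmTySub σ t) (μ-tmTySub σ u)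
  μ-tmTySub σ (δ⊗ t A B u)   = cong₂ (λ m n → suc (m + n)) (μ-tmTySub σ t) (μ-tmTySub σ u)
  μ-tmTySub σ triv           = refl
  μ-tmTySub σ (δ𝟘 t)         = cong suc (μ-tmTySub σ t)
  μ-tmTySub σ (wpair t u)    = cong₂ (λ m n → suc (m ⊔ n)) (μ-tmTySub σ t) (μ-tmTySub σ u)
  μ-tmTySub σ (δ&₁ t A u)    = cong₂ (λ m n → suc (m + n)) (μ-tmTySub σ t) (μ-tmTySub σ u)
  μ-tmTySub σ (δ&₂ t A u)    = cong₂ (λ m n → suc (m + n)) (μ-tmTySub σ t) (μ-tmTySub σ u)
  μ-tmTySub σ (inl t)        = cong suc (μ-tmTySub σ t)
  μ-tmTySub σ (inr t)        = cong suc (μ-tmTySub σ t)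
  μ-tmTySub σ (δ⊕ t A u B v) = cong₂ (λ m n → suc (m + n)) (μ-tmTySub σ t)
                                 (cong₂ _⊔_ (μ-tmTySub σ u) (μ-tmTySub σ v))
  μ-tmTySub σ (Λ t)          = cong suc (μ-tmTySub (extsT σ) t)
  μ-tmTySub σ (tapp t A)     = cong suc (μ-tmTySub σ t)

  weight : Ctx → (ℕ → Tm) → ℕ
  weight []            σ = 0
  weight (just _ ∷ Γ)  σ = μ (σ 0) + weight Γ (σ ∘ suc)
  weight (nothing ∷ Γ) σ = weight Γ (σ ∘ suc)

  weight-cong : ∀ Γ {σ τ} → (∀ n → μ (σ n) ≡ μ (τ n)) → weight Γ σ ≡ weight Γ τ
  weight-cong []            eq = refl
  weight-cong (just _ ∷ Γ)  eq = cong₂ _+_ (eq 0) (weight-cong Γ (eq ∘ suc))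
  weight-cong (nothing ∷ Γ) eq = weight-cong Γ (eq ∘ suc)

  weight-vars : ∀ Γ ρ → weight Γ (var ∘ ρ) ≡ 0
  weight-vars []            ρ = refl
  weight-vars (just _ ∷ Γ)  ρ = weight-vars Γ (ρ ∘ suc)
  weight-vars (nothing ∷ Γ) ρ = weight-vars Γ (ρ ∘ suc)

  weight-empty : ∀ {Γ} → Empty Γ → ∀ σ → weight Γ σ ≡ 0
  weight-empty []     σ = refl
  weight-empty (∅∷ e) σ = weight-empty e (σ ∘ suc)

  weight-only : ∀ {x A Γ} → Only x A Γ → ∀ σ → weight Γ σ ≡ μ (σ x)
  weight-only (here e)  σ = trans (cong (μ (σ 0) +_) (weight-empty e (σ ∘ suc))) (+-identityʳ _)
  weight-only (there o) σ = weight-only o (σ ∘ suc)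

  weight-split : ∀ {Ξ Γ Δ} → Split Ξ Γ Δ → ∀ σ → weight Ξ σ ≡ weight Γ σ + weight Δ σ
  weight-split []         σ = refl
  weight-split (left sp) σ =
    trans (cong (μ (σ 0) +_) (weight-split sp (σ ∘ suc))) (sym (+-assoc (μ (σ 0)) _ _))
  weight-split {Γ = _ ∷ Γ} {_ ∷ Δ} (right sp) σ =
    trans (cong (μ (σ 0) +_) (weight-split sp (σ ∘ suc)))
          (x+[y+z]≡y+[x+z] (μ (σ 0)) (weight Γ (σ ∘ suc)) (weight Δ (σ ∘ suc)))
  weight-split (absent sp) σ = weight-split sp (σ ∘ suc)

  weight-splitˡ-≤ : ∀ {Ξ Γ Δ} → Split Ξ Γ Δ → ∀ σ → weight Γ σ ≤ weight Ξ σ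
  weight-splitˡ-≤ {Γ = Γ} {Δ} sp σ =
    ≤-trans (m≤m+n (weight Γ σ) (weight Δ σ)) (≤-reflexive (sym (weight-split sp σ)))

  weight-exts : ∀ A Γ σ → weight (just A ∷ Γ) (exts σ) ≡ weight Γ σ
  weight-exts A Γ σ = weight-cong Γ (μ-tmRen suc ∘ σ)

  weight-ctxShift : ∀ Γ σ → weight (ctxShift Γ) (tmTyShift ∘ σ) ≡ weight Γ σ
  weight-ctxShift []            σ = refl
  weight-ctxShift (just _ ∷ Γ)  σ =
    cong₂ _+_ (μ-tmTySub _ (σ 0)) (weight-ctxShift Γ (σ ∘ suc))
  weight-ctxShift (nothing ∷ Γ) σ = weight-ctxShift Γ (σ ∘ suc)

  +-mono-≤-weight : ∀ {Ξ Γ Δ σ a b} x y → Split Ξ Γ Δ →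
                    a ≤ x + weight Γ σ → b ≤ y + weight Δ σ → a + b ≤ (x + y) + weight Ξ σ
  +-mono-≤-weight {Ξ} {Γ} {Δ} {σ} {a} {b} x y sp a≤ b≤ = begin
    a + b                                 ≤⟨ +-mono-≤ a≤ b≤ ⟩
    (x + weight Γ σ) + (y + weight Δ σ)   ≡⟨ +-interchange x _ y _ ⟩
    (x + y) + (weight Γ σ + weight Δ σ)   ≡⟨ cong ((x + y) +_) (weight-split sp σ) ⟨
    (x + y) + weight Ξ σ                  ∎
    where open ≤-Reasoning

  ≤-+-weight-cong : ∀ {a x w w'} → w ≡ w' → a ≤ x + w → a ≤ x + w'
  ≤-+-weight-cong {a} {x} eq = subst (λ w → a ≤ x + w) eq

  μ-tmSub-≤ : ∀ {Γ t A} → Γ ⊢ t ∶ A → ∀ σ → μ (tmSub σ t) ≤ μ t + weight Γ σ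
  μ-tmSub-≤ (ax o)  σ = ≤-reflexive (sym (weight-only o σ))
  μ-tmSub-≤ {Γ} (sum {t = t} {u} d e) σ =
    s≤s (⊔-mono-≤-+ (μ t) (μ u) (weight Γ σ) (μ-tmSub-≤ d σ) (μ-tmSub-≤ e σ))
  μ-tmSub-≤ (prod a d) σ = s≤s (μ-tmSub-≤ d σ)
  μ-tmSub-≤ (𝟙i a e)   σ = m≤m+n 1 _
  μ-tmSub-≤ (𝟙e {t = t} {u} sp d e) σ =
    s≤s (+-mono-≤-weight (μ t) (μ u) sp (μ-tmSub-≤ d σ) (μ-tmSub-≤ e σ))
  μ-tmSub-≤ {Γ} (⊸i {A = A} d) σ =
    s≤s (≤-+-weight-cong (weight-exts A Γ σ) (μ-tmSub-≤ d (exts σ)))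
  μ-tmSub-≤ (⊸e {t = t} {u} sp d e) σ =
    s≤s (+-mono-≤-weight (μ t) (μ u) sp (μ-tmSub-≤ d σ) (μ-tmSub-≤ e σ))
  μ-tmSub-≤ (⊗i {t = t} {u} sp d e) σ =
    s≤s (+-mono-≤-weight (μ t) (μ u) sp (μ-tmSub-≤ d σ) (μ-tmSub-≤ e σ))
  μ-tmSub-≤ (⊗e {Δ = Δ} {t} {u} {A} {B} sp d e) σ =
    s≤s (+-mono-≤-weight (μ t) (μ u) sp (μ-tmSub-≤ d σ)
      (≤-+-weight-cong (trans (weight-exts B (just A ∷ Δ) (exts σ)) (weight-exts A Δ σ))
        (μ-tmSub-≤ e (exts (exts σ)))))
  μ-tmSub-≤ ⊤i σ = s≤s z≤n
  μ-tmSub-≤ (𝟘e {t = t} sp d) σ =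
    s≤s (≤-trans (μ-tmSub-≤ d σ) (+-monoʳ-≤ (μ t) (weight-splitˡ-≤ sp σ)))
  μ-tmSub-≤ {Γ} (&i {t = t} {u} d e) σ =
    s≤s (⊔-mono-≤-+ (μ t) (μ u) (weight Γ σ) (μ-tmSub-≤ d σ) (μ-tmSub-≤ e σ))
  μ-tmSub-≤ (&e₁ {Δ = Δ} {t} {u} {A} sp d e) σ =
    s≤s (+-mono-≤-weight (μ t) (μ u) sp (μ-tmSub-≤ d σ)
      (≤-+-weight-cong (weight-exts A Δ σ) (μ-tmSub-≤ e (exts σ))))
  μ-tmSub-≤ (&e₂ {Δ = Δ} {t} {u} {B = B} sp d e) σ =
    s≤s (+-mono-≤-weight (μ t) (μ u) sp (μ-tmSub-≤ d σ)
      (≤-+-weight-cong (weight-exts B Δ σ) (μ-tmSub-≤ e (exts σ))))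
  μ-tmSub-≤ (⊕i₁ d) σ = s≤s (μ-tmSub-≤ d σ)
  μ-tmSub-≤ (⊕i₂ d) σ = s≤s (μ-tmSub-≤ d σ)
  μ-tmSub-≤ (⊕e {Δ = Δ} {t} {u} {v} {A} {B} sp d e f) σ =
    s≤s (+-mono-≤-weight (μ t) (μ u ⊔ μ v) sp (μ-tmSub-≤ d σ)
      (⊔-mono-≤-+ (μ u) (μ v) (weight Δ σ)
        (≤-+-weight-cong (weight-exts A Δ σ) (μ-tmSub-≤ e (exts σ)))
        (≤-+-weight-cong (weight-exts B Δ σ) (μ-tmSub-≤ f (exts σ)))))
  μ-tmSub-≤ {Γ} (∀i d) σ =
    s≤s (≤-+-weight-cong (weight-ctxShift Γ σ) (μ-tmSub-≤ d (tmTyShift ∘ σ)))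
  μ-tmSub-≤ (∀e A d) σ = s≤s (μ-tmSub-≤ d σ)

  μ-sub1-≤ : ∀ {Γ t A B} → just A ∷ Γ ⊢ t ∶ B → ∀ u → μ (sub1 u t) ≤ μ u + μ t
  μ-sub1-≤ {Γ} {t} d u = begin
    μ (sub1 u t)                      ≤⟨ μ-tmSub-≤ d _ ⟩
    μ t + (μ u + weight Γ (var ∘ id)) ≡⟨ cong (λ w → μ t + (μ u + w)) (weight-vars Γ id) ⟩
    μ t + (μ u + 0)                   ≡⟨ cong (μ t +_) (+-identityʳ (μ u)) ⟩
    μ t + μ u                         ≡⟨ +-comm (μ t) (μ u) ⟩
    μ u + μ t                         ∎
    where open ≤-Reasoning

  μ-sub2-≤ : ∀ {Γ w A B C} → just B ∷ just A ∷ Γ ⊢ w ∶ C → ∀ u v →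
             μ (sub2 u v w) ≤ (μ u + μ v) + μ w
  μ-sub2-≤ {Γ} {w} d u v = begin
    μ (sub2 u v w)                             ≤⟨ μ-tmSub-≤ d _ ⟩
    μ w + (μ v + (μ u + weight Γ (var ∘ id)))  ≡⟨ cong (λ z → μ w + (μ v + (μ u + z))) (weight-vars Γ id) ⟩
    μ w + (μ v + (μ u + 0))                    ≡⟨ cong (λ z → μ w + (μ v + z)) (+-identityʳ (μ u)) ⟩
    μ w + (μ v + μ u)                          ≡⟨ x+[y+z]≡[z+y]+x (μ w) (μ v) (μ u) ⟩
    (μ u + μ v) + μ w                          ∎
    where open ≤-Reasoning

  μ-nonincreasing : ∀ {Γ t u A} → Γ ⊢ t ∶ A → t ⟶ u → μ u ≤ μ t
  μ-nonincreasing _ β𝟙 = n≤1+n _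
  μ-nonincreasing (⊸e _ (⊸i d) _) (β⊸ {t = t} {u}) =
    m≤n⇒m≤o+n 2 (≤-trans (μ-sub1-≤ d u) (≤-reflexive (+-comm (μ u) (μ t))))
  μ-nonincreasing (⊗e _ _ e) β⊗ = m≤n⇒m≤o+n 2 (μ-sub2-≤ e _ _)
  μ-nonincreasing (&e₁ _ _ e) (β&₁ {t₁} {t₂} {v = v}) =
    m≤n⇒m≤o+n 2 (≤-trans (μ-sub1-≤ e t₁) (+-monoˡ-≤ (μ v) (m≤m⊔n (μ t₁) (μ t₂))))
  μ-nonincreasing (&e₂ _ _ e) (β&₂ {t₁} {t₂} {v = v}) =
    m≤n⇒m≤o+n 2 (≤-trans (μ-sub1-≤ e t₂) (+-monoˡ-≤ (μ v) (m≤n⊔m (μ t₁) (μ t₂))))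
  μ-nonincreasing (⊕e _ _ e _) (β⊕₁ {t} {v = v} {w = w}) =
    m≤n⇒m≤o+n 2 (≤-trans (μ-sub1-≤ e t) (+-monoʳ-≤ (μ t) (m≤m⊔n (μ v) (μ w))))
  μ-nonincreasing (⊕e _ _ _ f) (β⊕₂ {u} {v = v} {w = w}) =
    m≤n⇒m≤o+n 2 (≤-trans (μ-sub1-≤ f u) (+-monoʳ-≤ (μ u) (m≤n⊔m (μ v) (μ w))))
  μ-nonincreasing _ (β∀ {t} {A}) = m≤n⇒m≤o+n 2 (≤-reflexive (μ-tmTySub _ t))
  μ-nonincreasing _ ⊞𝟙 = s≤s z≤n
  μ-nonincreasing _ ⊞⊸ = ≤-refl
  μ-nonincreasing _ (⊞⊗ {t} {u} {v = v}) = s≤s (s≤s (≤-reflexive (sym (+-distribʳ-⊔ (μ v) (μ t) (μ u)))))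
  μ-nonincreasing _ ⊞⊤ = s≤s z≤n
  μ-nonincreasing _ (⊞& {t} {u} {v} {w}) = s≤s (s≤s (≤-reflexive (⊔-interchange (μ t) (μ v) (μ u) (μ w))))
  μ-nonincreasing _ (⊞⊕ {t} {u} {v = v} {w = w}) =
    s≤s (s≤s (≤-reflexive (sym (+-distribʳ-⊔ (μ v ⊔ μ w) (μ t) (μ u)))))
  μ-nonincreasing _ ⊞∀ = ≤-refl
  μ-nonincreasing _ •𝟙 = s≤s z≤n
  μ-nonincreasing _ •⊸ = ≤-refl
  μ-nonincreasing _ •⊗ = ≤-refl
  μ-nonincreasing _ •⊤ = s≤s z≤n
  μ-nonincreasing _ •& = ≤-refl
  μ-nonincreasing _ •⊕ = ≤-refl
  μ-nonincreasing _ •∀ = ≤-refl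
  μ-nonincreasing (sum {u = u} d _) (c⊞₁ r) = s≤s (⊔-monoˡ-≤ (μ u) (μ-nonincreasing d r))
  μ-nonincreasing (sum {t = t} _ e) (c⊞₂ r) = s≤s (⊔-monoʳ-≤ (μ t) (μ-nonincreasing e r))
  μ-nonincreasing (prod _ d) (c• r) = s≤s (μ-nonincreasing d r)
  μ-nonincreasing (𝟙e _ d _) (cδ𝟙₁ r) = s≤s (+-monoˡ-≤ _ (μ-nonincreasing d r))
  μ-nonincreasing (𝟙e _ _ e) (cδ𝟙₂ r) = s≤s (+-monoʳ-≤ _ (μ-nonincreasing e r))
  μ-nonincreasing (⊸i d) (clam r) = s≤s (μ-nonincreasing d r)
  μ-nonincreasing (⊸e _ d _) (capp₁ r) = s≤s (+-monoˡ-≤ _ (μ-nonincreasing d r))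
  μ-nonincreasing (⊸e _ _ e) (capp₂ r) = s≤s (+-monoʳ-≤ _ (μ-nonincreasing e r))
  μ-nonincreasing (⊗i _ d _) (ctens₁ r) = s≤s (+-monoˡ-≤ _ (μ-nonincreasing d r))
  μ-nonincreasing (⊗i _ _ e) (ctens₂ r) = s≤s (+-monoʳ-≤ _ (μ-nonincreasing e r))
  μ-nonincreasing (⊗e _ d _) (cδ⊗₁ r) = s≤s (+-monoˡ-≤ _ (μ-nonincreasing d r))
  μ-nonincreasing (⊗e _ _ e) (cδ⊗₂ r) = s≤s (+-monoʳ-≤ _ (μ-nonincreasing e r))
  μ-nonincreasing (𝟘e _ d) (cδ𝟘 r) = s≤s (μ-nonincreasing d r)
  μ-nonincreasing (&i {u = u} d _) (cpair₁ r) = s≤s (⊔-monoˡ-≤ (μ u) (μ-nonincreasing d r))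
  μ-nonincreasing (&i {t = t} _ e) (cpair₂ r) = s≤s (⊔-monoʳ-≤ (μ t) (μ-nonincreasing e r))
  μ-nonincreasing (&e₁ _ d _) (cδ&₁₁ r) = s≤s (+-monoˡ-≤ _ (μ-nonincreasing d r))
  μ-nonincreasing (&e₁ _ _ e) (cδ&₁₂ r) = s≤s (+-monoʳ-≤ _ (μ-nonincreasing e r))
  μ-nonincreasing (&e₂ _ d _) (cδ&₂₁ r) = s≤s (+-monoˡ-≤ _ (μ-nonincreasing d r))
  μ-nonincreasing (&e₂ _ _ e) (cδ&₂₂ r) = s≤s (+-monoʳ-≤ _ (μ-nonincreasing e r))
  μ-nonincreasing (⊕i₁ d) (cinl r) = s≤s (μ-nonincreasing d r)
  μ-nonincreasing (⊕i₂ d) (cinr r) = s≤s (μ-nonincreasing d r)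
  μ-nonincreasing (⊕e _ d _ _) (cδ⊕₁ r) = s≤s (+-monoˡ-≤ _ (μ-nonincreasing d r))
  μ-nonincreasing (⊕e {t = t} {v = v} _ _ e _) (cδ⊕₂ r) =
    s≤s (+-monoʳ-≤ (μ t) (⊔-monoˡ-≤ (μ v) (μ-nonincreasing e r)))
  μ-nonincreasing (⊕e {t = t} {u = u} _ _ _ f) (cδ⊕₃ r) =
    s≤s (+-monoʳ-≤ (μ t) (⊔-monoʳ-≤ (μ u) (μ-nonincreasing f r)))
  μ-nonincreasing (∀i d) (cΛ r) = s≤s (μ-nonincreasing d r)
  μ-nonincreasing (∀e _ d) (ctapp r) = s≤s (μ-nonincreasing d r)

lemma31 : ∀ {c ℓ : Level} (S : Semiring c ℓ) → let open Calc S in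
            ∀ {Γ : Ctx} {t u : Tm} {A : Ty} → Γ ⊢ t ∶ A → t ⟶ u → μ t ≥ μ u
lemma31 = μ-nonincreasing
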